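{- If $(\mu^{\le k}_{ -n}(\mathbf{b},\boldsymbol{\lambda}))_{n\ge1}$ is well defined, then, as rational functions in $x$, \[ \sum_{n\ge1}\mu^{\le k}_{ -n}(\mathbf{b},\boldsymbol{\lambda})x^n=\cfrac{ -x}{x-b_0-\cfrac{\lambda_1}{x-b_1-\cfrac{\lambda_2}{x-b_2-\cdots-\cfrac{\lambda_k}{x-b_k}}}}. \]
   Context: $\mathbf{b}=(b_i)_{i\ge0}$, $\boldsymbol{\lambda}=(\lambda_i)_{i\ge1}$ are sequences in a field and $k\ge0$. A Motzkin path is a finite sequence of points in $\mathbb{Z}\times\mathbb{Z}_{\ge0}$ whose steps are each $(1,1)$, $(1,0)$ or $(1,-1)$; its weight is the product of $b_i$ over horizontal steps starting at height $i$ and $\lambda_i$ over down steps starting at height $i$. $\mu^{\le k}_n(\mathbf{b},\boldsymbol{\lambda})$ ($n\ge0$) is the sum of weights of Motzkin paths from $(0,0)$ to $(n,0)$ staying weakly below $y=k$. If this sequence satisfies a recurrence $f_n=c_1f_{n-1}+\cdots+c_df_{n-d}$ for all $n\ge d$ with $c_d\ne0$, it is extended uniquely to all $n\in\mathbb{Z}$ so the recurrence holds for all $n$; "well defined" means such a recurrence exists, and $\mu^{\le k}_{ -n}$ are the extended values. -}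

module Defs where

open import Level using (Level)
open import Algebra.Bundles using (CommutativeRing)
open import Data.Nat using (ℕ; zero; suc; _∸_; _≤_; _<ᵇ_; _≡ᵇ_)
open import Data.Integer using (ℤ; +_; -[1+_]) renaming (_-_ to _-ℤ_)
open import Data.Bool using (Bool; true; false; if_then_else_; _∧_)
open import Data.List using (List; []; _∷_; map; foldr; filterᵇ; concatMap)
open import Data.Product using (_×_; _,_; Σ)
open import Relation.Nullary using (¬_)

record IsField {c ℓ : Level} (R : CommutativeRing c ℓ) : Set (c Level.⊔ ℓ) where
  open CommutativeRing R hiding (zero)
  field
    1≉0    : ¬ (1# ≈ 0#)
    inverse : ∀ x → ¬ (x ≈ 0#) → Σ Carrier (λ y → x * y ≈ 1#)

data Step : Set where
  up flat down : Step

allSeqs : ℕ → List (List Step)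
allSeqs zero = [] ∷ []
allSeqs (suc n) = concatMap (λ p → (up ∷ p) ∷ (flat ∷ p) ∷ (down ∷ p) ∷ []) (allSeqs n)


isMotzkin : ℕ → ℕ → List Step → Bool
isMotzkin k zero [] = true
isMotzkin k (suc h) [] = false
isMotzkin k h (up ∷ p) = if h <ᵇ k then isMotzkin k (suc h) p else false
isMotzkin k h (flat ∷ p) = isMotzkin k h p
isMotzkin k zero (down ∷ p) = false
isMotzkin k (suc h) (down ∷ p) = isMotzkin k h p

module _ {c ℓ : Level} (R : CommutativeRing c ℓ) where
  open CommutativeRing R hiding (zero)

  sumL : List Carrier → Carrier
  sumL = foldr _+_ 0#

  -- weight of a path starting at height h: b_i per horizontal step at
  -- height i, λ_i per down step starting at height i.
  weight : (ℕ → Carrier) → (ℕ → Carrier) → ℕ → List Step → Carrier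
  weight b lam h [] = 1#
  weight b lam h (up ∷ p) = weight b lam (suc h) p
  weight b lam h (flat ∷ p) = b h * weight b lam h p
  weight b lam zero (down ∷ p) = weight b lam zero p   -- never occurs on a Motzkin path
  weight b lam (suc h) (down ∷ p) = lam (suc h) * weight b lam h p

  mu : ℕ → (ℕ → Carrier) → (ℕ → Carrier) → ℕ → Carrier
  mu k b lam n = sumL (map (weight b lam 0) (filterᵇ (isMotzkin k 0) (allSeqs n)))

  sum1to : ℕ → (ℕ → Carrier) → Carrier
  sum1to zero f = 0#
  sum1to (suc d) f = sum1to d f + f (suc d)

  sum0to : ℕ → (ℕ → Carrier) → Carrier
  sum0to zero f = f 0
  sum0to (suc n) f = sum0to n f + f (suc n)

  -- Formal power series in x (polynomials are those of finite support),
  -- given by coefficient sequences.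
  Series : Set c
  Series = ℕ → Carrier

  _⊕_ : Series → Series → Series
  (A ⊕ B) n = A n + B n

  _⊖_ : Series → Series → Series
  (A ⊖ B) n = A n + (- B n)

  _⊛_ : Series → Series → Series
  (A ⊛ B) n = sum0to n (λ i → A i * B (n ∸ i))

  const : Carrier → Series
  const a zero = a
  const a (suc n) = 0#

  X : Series
  X n = if n ≡ᵇ 1 then 1# else 0#

  -- Numerator/denominator of the tail T_j of the continued fraction, with m
  -- levels below j:  T_{j} = x - b_j - λ_{j+1}/T_{j+1},  T_k = x - b_k.
  cfTail : (ℕ → Carrier) → (ℕ → Carrier) → ℕ → ℕ → Series × Series
  cfTail b lam zero j = (X ⊖ const (b j)) , const 1#
  cfTail b lam (suc m) j with cfTail b lam m (suc j)
  ... | (N , D) = (((X ⊖ const (b j)) ⊛ N) ⊖ (const (lam (suc j)) ⊛ D)) , N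

  -- The continued fraction  -x / (x - b_0 - λ_1/(x - b_1 - ... - λ_k/(x - b_k)))
  -- as a pair (numerator P, denominator Q) of polynomials.
  cfNum : ℕ → (ℕ → Carrier) → (ℕ → Carrier) → Series
  cfNum k b lam with cfTail b lam k 0
  ... | (N , D) = const (- 1#) ⊛ (X ⊛ D)

  cfDen : ℕ → (ℕ → Carrier) → (ℕ → Carrier) → Series
  cfDen k b lam with cfTail b lam k 0
  ... | (N , D) = N

  RecNat : ℕ → (ℕ → Carrier) → (ℕ → Carrier) → Set ℓ
  RecNat d cs f = ∀ n → d ≤ n → f n ≈ sum1to d (λ i → cs i * f (n ∸ i))

  RecInt : ℕ → (ℕ → Carrier) → (ℤ → Carrier) → Set ℓ
  RecInt d cs g = ∀ (n : ℤ) → g n ≈ sum1to d (λ i → cs i * g (n -ℤ + i))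

  negSeries : (ℤ → Carrier) → Series
  negSeries g zero = 0#
  negSeries g (suc n) = g -[1+ n ]

-- Let p_h be the monic orthogonal polynomials of the weights, p_{h+1} = (x - b_h) p_h - λ_h p_{h-1},
-- and q_h those of the shifted weights (b_{i+1}), (λ_{i+1}); the continued fraction is -x q_k / p_{k+1}.
-- Splitting a path at its first step shows that the moment functional L(x^n) = μ_n sends x^r p_h to
-- the weighted number of paths of length r from height h down to 0, which is 0 for h = k + 1. So the
-- coefficients of p_{k+1} combine the extended sequence g into a solution of the given recurrence on ℤ
-- that vanishes on ℕ; as c_d is invertible the recurrence runs backwards and it vanishes on all of ℤ.
-- At negative indices this says that p_{k+1} Σ_{n≥1} g(-n) x^n is minus x times the polynomial part of
-- p_{k+1}(x) Σ_n μ_n x^{-n-1}, and that polynomial part is q_k.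
{-# OPTIONS --safe #-}
module Submission where

open import Defs
open import Level using (Level)
open import Algebra.Bundles using (CommutativeRing)
open import Data.Nat using (ℕ; zero; suc; _≤_; _<_; _∸_; z≤n; s≤s; _<ᵇ_) renaming (_+_ to _+ℕ_)
import Data.Nat.Properties as ℕ
open import Data.Integer using (ℤ; +_; -[1+_]) renaming (_+_ to _+ℤ_; _-_ to _-ℤ_; -_ to -ℤ_)
import Data.Integer.Properties as ℤ
open import Data.Integer.Tactic.RingSolver using (solve-∀)
open import Data.Bool using (Bool; true; false; if_then_else_)
open import Data.List using (List; []; _∷_; _++_; map; filterᵇ; concatMap)
open import Data.Product using (_×_; _,_; proj₁; proj₂)
open import Data.Empty using (⊥-elim)
open import Data.Unit using (tt)
open import Function using (id)
open import Relation.Nullary using (¬_)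
open import Relation.Binary.PropositionalEquality as ≡ using (_≡_)
import Algebra.Solver.Ring.NaturalCoefficients.Default as NaturalCoefficients

+-sub-comm : ∀ (z a b : ℤ) → (z +ℤ a) -ℤ b ≡ (z -ℤ b) +ℤ a
+-sub-comm = solve-∀

suc-sub-suc : ∀ t m → + suc t -ℤ + suc m ≡ + t -ℤ + m
suc-sub-suc t m = lemma (+ t) (+ m)
  where
  lemma : ∀ (a b : ℤ) → (+ 1 +ℤ a) -ℤ (+ 1 +ℤ b) ≡ a -ℤ b
  lemma = solve-∀

sub-sub-≤ : ∀ {i d} m → i ≤ d → (+ d -ℤ + m) -ℤ + i ≡ + (d ∸ i) -ℤ + m
sub-sub-≤ {i} {d} m i≤d = ≡.trans (swap (+ d) (+ m) (+ i)) (≡.cong (_-ℤ + m) (≡.trans (ℤ.m-n≡m⊖n d i) (ℤ.⊖-≥ i≤d)))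
  where
  swap : ∀ (a b c : ℤ) → (a -ℤ b) -ℤ c ≡ (a -ℤ c) -ℤ b
  swap = solve-∀

sub-sub-suc : ∀ d m → (+ d -ℤ + m) -ℤ + suc d ≡ -[1+ m ]
sub-sub-suc d m = lemma (+ d) (+ m)
  where
  lemma : ∀ (a b : ℤ) → (a -ℤ b) -ℤ (+ 1 +ℤ a) ≡ -ℤ (+ 1 +ℤ b)
  lemma = solve-∀

-[1+]-+-≤ : ∀ {i m} → i ≤ m → -[1+ m ] +ℤ + i ≡ -[1+ (m ∸ i) ]
-[1+]-+-≤ {i} {m} i≤m = ≡.trans (≡.cong (λ u → -[1+ u ] +ℤ + i) (≡.sym (ℕ.m∸n+n≡m i≤m))) (lemma (+ (m ∸ i)) (+ i))
  where
  lemma : ∀ (a b : ℤ) → -ℤ (+ 1 +ℤ (a +ℤ b)) +ℤ b ≡ -ℤ (+ 1 +ℤ a)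
  lemma = solve-∀

-[1+]-+-suc : ∀ m i → -[1+ m ] +ℤ + suc (m +ℕ i) ≡ + i
-[1+]-+-suc m i = lemma (+ m) (+ i)
  where
  lemma : ∀ (a b : ℤ) → -ℤ (+ 1 +ℤ a) +ℤ (+ 1 +ℤ (a +ℤ b)) ≡ b
  lemma = solve-∀

module _ {c ℓ : Level} (R : CommutativeRing c ℓ) where
  open CommutativeRing R hiding (zero)
  open import Relation.Binary.Reasoning.Setoid setoid
  open import Algebra.Properties.Ring ring using (-‿distribˡ-*; -1*x≈-x)
  open import Algebra.Properties.AbelianGroup +-abelianGroup using (⁻¹-∙-comm; ε⁻¹≈ε; inverseˡ-unique)
  open import Algebra.Properties.CommutativeSemigroup +-commutativeSemigroup using (interchange)
  open import Algebra.Properties.CommutativeSemigroup *-commutativeSemigroup using (x∙yz≈y∙xz)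
  open NaturalCoefficients commutativeSemiring using (solve; _:=_; _:+_; _:*_)

  sum0to-cong-≤ : ∀ n {f g : ℕ → Carrier} → (∀ i → i ≤ n → f i ≈ g i) → sum0to R n f ≈ sum0to R n g
  sum0to-cong-≤ zero e = e 0 z≤n
  sum0to-cong-≤ (suc n) e = +-cong (sum0to-cong-≤ n (λ i i≤n → e i (ℕ.m≤n⇒m≤1+n i≤n))) (e (suc n) ℕ.≤-refl)

  sum0to-cong : ∀ n {f g : ℕ → Carrier} → (∀ i → f i ≈ g i) → sum0to R n f ≈ sum0to R n g
  sum0to-cong n e = sum0to-cong-≤ n (λ i _ → e i)

  sum1to-cong : ∀ d {f g : ℕ → Carrier} → (∀ i → f i ≈ g i) → sum1to R d f ≈ sum1to R d g
  sum1to-cong zero e = refl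
  sum1to-cong (suc d) e = +-cong (sum1to-cong d e) (e (suc d))

  sum0to-zero : ∀ n {f : ℕ → Carrier} → (∀ i → f i ≈ 0#) → sum0to R n f ≈ 0#
  sum0to-zero zero e = e 0
  sum0to-zero (suc n) e = trans (+-cong (sum0to-zero n e) (e (suc n))) (+-identityˡ 0#)

  sum1to-zero-≤ : ∀ d {f : ℕ → Carrier} → (∀ i → i ≤ d → f i ≈ 0#) → sum1to R d f ≈ 0#
  sum1to-zero-≤ zero e = refl
  sum1to-zero-≤ (suc d) e =
    trans (+-cong (sum1to-zero-≤ d (λ i i≤d → e i (ℕ.m≤n⇒m≤1+n i≤d))) (e (suc d) ℕ.≤-refl)) (+-identityˡ 0#)

  sum0to-distrib-+ : ∀ n (f g : ℕ → Carrier) → sum0to R n (λ i → f i + g i) ≈ sum0to R n f + sum0to R n g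
  sum0to-distrib-+ zero f g = refl
  sum0to-distrib-+ (suc n) f g = trans (+-congʳ (sum0to-distrib-+ n f g)) (interchange _ _ _ _)

  -‿sum0to : ∀ n (f : ℕ → Carrier) → - sum0to R n f ≈ sum0to R n (λ i → - f i)
  -‿sum0to zero f = refl
  -‿sum0to (suc n) f = trans (sym (⁻¹-∙-comm _ _)) (+-congʳ (-‿sum0to n f))

  *-distribˡ-sum0to : ∀ n x (f : ℕ → Carrier) → x * sum0to R n f ≈ sum0to R n (λ i → x * f i)
  *-distribˡ-sum0to zero x f = refl
  *-distribˡ-sum0to (suc n) x f = trans (distribˡ x _ _) (+-congʳ (*-distribˡ-sum0to n x f))

  *-distribˡ-sum1to : ∀ d x (f : ℕ → Carrier) → x * sum1to R d f ≈ sum1to R d (λ i → x * f i)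
  *-distribˡ-sum1to zero x f = zeroʳ x
  *-distribˡ-sum1to (suc d) x f = trans (distribˡ x _ _) (+-congʳ (*-distribˡ-sum1to d x f))

  sum0to-sucˡ : ∀ n (f : ℕ → Carrier) → sum0to R (suc n) f ≈ f 0 + sum0to R n (λ i → f (suc i))
  sum0to-sucˡ zero f = refl
  sum0to-sucˡ (suc n) f = trans (+-congʳ (sum0to-sucˡ n f)) (+-assoc _ _ _)

  sum0to-head : ∀ n (f : ℕ → Carrier) → (∀ i → f (suc i) ≈ 0#) → sum0to R n f ≈ f 0
  sum0to-head zero f e = refl
  sum0to-head (suc n) f e = trans (sum0to-sucˡ n f) (trans (+-congˡ (sum0to-zero n e)) (+-identityʳ _))

  sum0to-sum1to-comm : ∀ n d (F : ℕ → ℕ → Carrier) →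
    sum0to R n (λ j → sum1to R d (λ i → F i j)) ≈ sum1to R d (λ i → sum0to R n (λ j → F i j))
  sum0to-sum1to-comm n zero F = sum0to-zero n (λ _ → refl)
  sum0to-sum1to-comm n (suc d) F = trans (sum0to-distrib-+ n _ _) (+-congʳ (sum0to-sum1to-comm n d F))

  sum0to-split : ∀ m n (f : ℕ → Carrier) →
    sum0to R (suc (m +ℕ n)) f ≈ sum0to R m f + sum0to R n (λ i → f (suc (m +ℕ i)))
  sum0to-split zero n f = sum0to-sucˡ n f
  sum0to-split (suc m) n f = begin
    sum0to R (suc (suc m +ℕ n)) f                                            ≈⟨ sum0to-sucˡ (suc (m +ℕ n)) f ⟩
    f 0 + sum0to R (suc (m +ℕ n)) (λ i → f (suc i))                         ≈⟨ +-congˡ (sum0to-split m n (λ i → f (suc i))) ⟩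
    f 0 + (sum0to R m (λ i → f (suc i)) + sum0to R n (λ i → f (suc (suc m +ℕ i)))) ≈⟨ +-assoc _ _ _ ⟨
    (f 0 + sum0to R m (λ i → f (suc i))) + sum0to R n (λ i → f (suc (suc m +ℕ i))) ≈⟨ +-congʳ (sum0to-sucˡ m f) ⟨
    sum0to R (suc m) f + sum0to R n (λ i → f (suc (suc m +ℕ i)))             ∎

  sum0to-pad : ∀ n t (f : ℕ → Carrier) → (∀ j → n < j → f j ≈ 0#) → sum0to R (n +ℕ t) f ≈ sum0to R n f
  sum0to-pad n zero f e = reflexive (≡.cong (λ u → sum0to R u f) (ℕ.+-identityʳ n))
  sum0to-pad n (suc t) f e = begin
    sum0to R (n +ℕ suc t) f              ≡⟨ ≡.cong (λ u → sum0to R u f) (ℕ.+-suc n t) ⟩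
    sum0to R (n +ℕ t) f + f (suc (n +ℕ t)) ≈⟨ +-cong (sum0to-pad n t f e) (e _ (s≤s (ℕ.m≤m+n n t))) ⟩
    sum0to R n f + 0#                    ≈⟨ +-identityʳ _ ⟩
    sum0to R n f                         ∎

  -- Polynomials as coefficient sequences

  mulX : Series R → Series R
  mulX A zero = 0#
  mulX A (suc n) = A n

  mulX-cong : ∀ {A B : Series R} → (∀ n → A n ≈ B n) → ∀ n → mulX A n ≈ mulX B n
  mulX-cong e zero = refl
  mulX-cong e (suc n) = e n

  mulX-linear : ∀ (A B : Series R) a n → mulX (λ i → A i + a * B i) n ≈ mulX A n + a * mulX B n
  mulX-linear A B a zero = sym (trans (+-congˡ (zeroʳ a)) (+-identityʳ 0#))
  mulX-linear A B a (suc n) = refl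

  +-scaled-zeros : ∀ a x y → (a + x * 0#) + y * 0# ≈ a
  +-scaled-zeros a x y = trans (+-cong (trans (+-congˡ (zeroʳ x)) (+-identityʳ a)) (zeroʳ y)) (+-identityʳ a)

  threeTerm : Carrier → Carrier → Series R → Series R → Series R
  threeTerm β γ A A′ n = (mulX A n + (- β) * A n) + (- γ) * A′ n

  threeTerm-cong : ∀ β γ {A B A′ B′ : Series R} → (∀ n → A n ≈ B n) → (∀ n → A′ n ≈ B′ n) →
                   ∀ n → threeTerm β γ A A′ n ≈ threeTerm β γ B B′ n
  threeTerm-cong β γ e e′ zero = +-cong (+-congˡ (*-congˡ (e 0))) (*-congˡ (e′ 0))
  threeTerm-cong β γ e e′ (suc n) = +-cong (+-cong (e n) (*-congˡ (e (suc n)))) (*-congˡ (e′ (suc n)))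

  threeTerm-zero : ∀ β γ A n → threeTerm β γ A (λ _ → 0#) n ≈ mulX A n + (- β) * A n
  threeTerm-zero β γ A n = trans (+-congˡ (zeroʳ _)) (+-identityʳ _)

  mulX-threeTerm : ∀ β γ A A′ n → mulX (threeTerm β γ A A′) n ≈ threeTerm β γ (mulX A) (mulX A′) n
  mulX-threeTerm β γ A A′ zero = sym (+-scaled-zeros 0# _ _)
  mulX-threeTerm β γ A A′ (suc n) = refl

  threeTerm-comm : ∀ β γ β′ γ′ A A′ C C′ n →
    threeTerm β γ (threeTerm β′ γ′ A A′) (threeTerm β′ γ′ C C′) n ≈
    threeTerm β′ γ′ (threeTerm β γ A C) (threeTerm β γ A′ C′) n
  threeTerm-comm β γ β′ γ′ A A′ C C′ n = begin
    (mulX (threeTerm β′ γ′ A A′) n + (- β) * threeTerm β′ γ′ A A′ n) + (- γ) * threeTerm β′ γ′ C C′ n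
      ≈⟨ +-congʳ (+-congʳ (mulX-threeTerm β′ γ′ A A′ n)) ⟩
    (threeTerm β′ γ′ (mulX A) (mulX A′) n + (- β) * threeTerm β′ γ′ A A′ n) + (- γ) * threeTerm β′ γ′ C C′ n
      ≈⟨ expand (mulX (mulX A) n) (mulX A n) (mulX A′ n) (A n) (A′ n) (mulX C n) (C n) (C′ n) (- β) (- γ) (- β′) (- γ′) ⟩
    (threeTerm β γ (mulX A) (mulX C) n + (- β′) * threeTerm β γ A C n) + (- γ′) * threeTerm β γ A′ C′ n
      ≈⟨ +-congʳ (+-congʳ (mulX-threeTerm β γ A C n)) ⟨
    (mulX (threeTerm β γ A C) n + (- β′) * threeTerm β γ A C n) + (- γ′) * threeTerm β γ A′ C′ n ∎
    where
    expand : ∀ xxa xa xa′ a a′ xc c c′ u v u′ v′ →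
      (((xxa + u′ * xa) + v′ * xa′) + u * ((xa + u′ * a) + v′ * a′)) + v * ((xc + u′ * c) + v′ * c′) ≈
      (((xxa + u * xa) + v * xc) + u′ * ((xa + u * a) + v * c)) + v′ * ((xa′ + u * a′) + v * c′)
    expand = solve 12 (λ xxa xa xa′ a a′ xc c c′ u v u′ v′ →
      (((xxa :+ u′ :* xa) :+ v′ :* xa′) :+ u :* ((xa :+ u′ :* a) :+ v′ :* a′)) :+ v :* ((xc :+ u′ :* c) :+ v′ :* c′) :=
      (((xxa :+ u :* xa) :+ v :* xc) :+ u′ :* ((xa :+ u :* a) :+ v :* c)) :+ v′ :* ((xa′ :+ u :* a′) :+ v :* c′)) refl

  ⊖-⊛ : ∀ A B C n → _⊛_ R (_⊖_ R A B) C n ≈ _⊛_ R A C n + - _⊛_ R B C n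
  ⊖-⊛ A B C n = begin
    sum0to R n (λ i → (A i + - B i) * C (n ∸ i))            ≈⟨ sum0to-cong n (λ i → trans (distribʳ _ _ _) (+-congˡ (sym (-‿distribˡ-* _ _)))) ⟩
    sum0to R n (λ i → A i * C (n ∸ i) + - (B i * C (n ∸ i))) ≈⟨ sum0to-distrib-+ n _ _ ⟩
    _⊛_ R A C n + sum0to R n (λ i → - (B i * C (n ∸ i)))     ≈⟨ +-congˡ (-‿sum0to n _) ⟨
    _⊛_ R A C n + - _⊛_ R B C n                              ∎

  const-⊛ : ∀ a C n → _⊛_ R (const R a) C n ≈ a * C n
  const-⊛ a C n = sum0to-head n _ (λ _ → zeroˡ _)

  X-⊛ : ∀ C n → _⊛_ R (X R) C n ≈ mulX C n
  X-⊛ C zero = zeroˡ _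
  X-⊛ C (suc n) = begin
    _⊛_ R (X R) C (suc n)                                      ≈⟨ sum0to-sucˡ n _ ⟩
    0# * C (suc n) + sum0to R n (λ i → X R (suc i) * C (n ∸ i)) ≈⟨ +-cong (zeroˡ _) (sum0to-head n _ (λ _ → zeroˡ _)) ⟩
    0# + 1# * C n                                              ≈⟨ +-identityˡ _ ⟩
    1# * C n                                                   ≈⟨ *-identityˡ _ ⟩
    C n                                                        ∎

  ⊛-threeTerm : ∀ β γ N D n →
    _⊖_ R (_⊛_ R (_⊖_ R (X R) (const R β)) N) (_⊛_ R (const R γ) D) n ≈ threeTerm β γ N D n
  ⊛-threeTerm β γ N D n = begin
    _⊛_ R (_⊖_ R (X R) (const R β)) N n + - _⊛_ R (const R γ) D n
      ≈⟨ +-cong (⊖-⊛ (X R) (const R β) N n) (-‿cong (const-⊛ γ D n)) ⟩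
    (_⊛_ R (X R) N n + - _⊛_ R (const R β) N n) + - (γ * D n)
      ≈⟨ +-congʳ (+-cong (X-⊛ N n) (-‿cong (const-⊛ β N n))) ⟩
    (mulX N n + - (β * N n)) + - (γ * D n)
      ≈⟨ +-cong (+-congˡ (-‿distribˡ-* β (N n))) (-‿distribˡ-* γ (D n)) ⟩
    threeTerm β γ N D n ∎

  pairing : ℕ → (ℕ → ℕ) → (ℕ → Carrier) → Series R → Carrier
  pairing n σ w A = sum0to R n (λ j → A (σ j) * w j)

  pairing-threeTerm : ∀ n σ w β γ A A′ →
    pairing n σ w (threeTerm β γ A A′) ≈
    (pairing n σ w (mulX A) + (- β) * pairing n σ w A) + (- γ) * pairing n σ w A′
  pairing-threeTerm n σ w β γ A A′ = begin
    pairing n σ w (threeTerm β γ A A′)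
      ≈⟨ sum0to-cong n (λ j → distribute _ _ _ _ _ _) ⟩
    sum0to R n (λ j → (mulX A (σ j) * w j + (- β) * (A (σ j) * w j)) + (- γ) * (A′ (σ j) * w j))
      ≈⟨ trans (sum0to-distrib-+ n _ _) (+-congʳ (sum0to-distrib-+ n _ _)) ⟩
    (pairing n σ w (mulX A) + sum0to R n (λ j → (- β) * (A (σ j) * w j))) + sum0to R n (λ j → (- γ) * (A′ (σ j) * w j))
      ≈⟨ +-cong (+-congˡ (*-distribˡ-sum0to n (- β) _)) (*-distribˡ-sum0to n (- γ) _) ⟨
    (pairing n σ w (mulX A) + (- β) * pairing n σ w A) + (- γ) * pairing n σ w A′ ∎
    where
    distribute : ∀ a u y v z t → ((a + u * y) + v * z) * t ≈ (a * t + u * (y * t)) + v * (z * t)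
    distribute = solve 6 (λ a u y v z t → ((a :+ u :* y) :+ v :* z) :* t := (a :* t :+ u :* (y :* t)) :+ v :* (z :* t)) refl

  pairing-zero : ∀ n σ w → pairing n σ w (λ _ → 0#) ≈ 0#
  pairing-zero n σ w = sum0to-zero n (λ _ → zeroˡ _)

  -- Orthogonal polynomials and the continued fraction

  shift : (ℕ → Carrier) → ℕ → Carrier
  shift f n = f (suc n)

  -- orthoPoly bs ls (suc h) is p_h, where p_{h+1} = (x - b_h) p_h - λ_h p_{h-1}, p_0 = 1 and p_{-1} = 0.
  orthoPoly : (ℕ → Carrier) → (ℕ → Carrier) → ℕ → Series R
  orthoPoly bs ls zero _ = 0#
  orthoPoly bs ls (suc zero) = const R 1#
  orthoPoly bs ls (suc (suc m)) = threeTerm (bs m) (ls m) (orthoPoly bs ls (suc m)) (orthoPoly bs ls m)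

  orthoPoly-degree : ∀ bs ls m n → m ≤ n → orthoPoly bs ls m n ≈ 0#
  orthoPoly-degree bs ls zero n _ = refl
  orthoPoly-degree bs ls (suc zero) (suc n) _ = refl
  orthoPoly-degree bs ls (suc (suc m)) (suc n) (s≤s m<n) = begin
    (orthoPoly bs ls (suc m) n + (- bs m) * orthoPoly bs ls (suc m) (suc n)) + (- ls m) * orthoPoly bs ls m (suc n)
      ≈⟨ +-cong (+-cong (orthoPoly-degree bs ls (suc m) n m<n)
                        (*-congˡ (orthoPoly-degree bs ls (suc m) (suc n) (ℕ.m≤n⇒m≤1+n m<n))))
                (*-congˡ (orthoPoly-degree bs ls m (suc n) (ℕ.≤-trans (ℕ.n≤1+n m) (ℕ.m≤n⇒m≤1+n m<n)))) ⟩
    (0# + (- bs m) * 0#) + (- ls m) * 0#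
      ≈⟨ +-scaled-zeros 0# _ _ ⟩
    0# ∎

  -- The recurrence peels off the last level (b_m, λ_m); cfTail instead peels off the first one.
  orthoPoly-expandFirst : ∀ m bs ls n →
    orthoPoly bs ls (suc (suc m)) n ≈
    threeTerm (bs 0) (ls 1) (orthoPoly (shift bs) (shift ls) (suc m)) (orthoPoly (shift (shift bs)) (shift (shift ls)) m) n
  orthoPoly-expandFirst zero bs ls n = +-congˡ (trans (zeroʳ _) (sym (zeroʳ _)))
  orthoPoly-expandFirst (suc zero) bs ls n = begin
    threeTerm (bs 1) (ls 1) (threeTerm (bs 0) (ls 0) one zero̅) one n
      ≈⟨ +-congʳ (+-cong (trans (mulX-cong (threeTerm-zero (bs 0) (ls 0) one) n) (mulX-linear _ _ _ n))
                         (*-congˡ (threeTerm-zero (bs 0) (ls 0) one n))) ⟩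
    ((mulX (mulX one) n + (- bs 0) * mulX one n) + (- bs 1) * (mulX one n + (- bs 0) * one n)) + (- ls 1) * one n
      ≈⟨ swapFactors _ _ _ _ _ _ ⟩
    ((mulX (mulX one) n + (- bs 1) * mulX one n) + (- bs 0) * (mulX one n + (- bs 1) * one n)) + (- ls 1) * one n
      ≈⟨ +-congʳ (+-cong (trans (mulX-cong (threeTerm-zero (bs 1) (ls 1) one) n) (mulX-linear _ _ _ n))
                         (*-congˡ (threeTerm-zero (bs 1) (ls 1) one n))) ⟨
    threeTerm (bs 0) (ls 1) (threeTerm (bs 1) (ls 1) one zero̅) one n ∎
    where
    one zero̅ : Series R
    one = const R 1#
    zero̅ _ = 0#
    swapFactors : ∀ p q r u v w → ((p + u * q) + v * (q + u * r)) + w * r ≈ ((p + v * q) + u * (q + v * r)) + w * r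
    swapFactors = solve 6 (λ p q r u v w →
      ((p :+ u :* q) :+ v :* (q :+ u :* r)) :+ w :* r := ((p :+ v :* q) :+ u :* (q :+ v :* r)) :+ w :* r) refl
  orthoPoly-expandFirst (suc (suc m)) bs ls n = begin
    threeTerm β γ (orthoPoly bs ls (suc (suc (suc m)))) (orthoPoly bs ls (suc (suc m))) n
      ≈⟨ threeTerm-cong β γ (orthoPoly-expandFirst (suc m) bs ls) (orthoPoly-expandFirst m bs ls) n ⟩
    threeTerm β γ (threeTerm (bs 0) (ls 1) (P (suc (suc m))) (P₂ (suc m))) (threeTerm (bs 0) (ls 1) (P (suc m)) (P₂ m)) n
      ≈⟨ threeTerm-comm β γ (bs 0) (ls 1) (P (suc (suc m))) (P₂ (suc m)) (P (suc m)) (P₂ m) n ⟩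
    threeTerm (bs 0) (ls 1) (threeTerm β γ (P (suc (suc m))) (P (suc m))) (threeTerm β γ (P₂ (suc m)) (P₂ m)) n ∎
    where
    β γ : Carrier
    β = bs (suc (suc m))
    γ = ls (suc (suc m))
    P P₂ : ℕ → Series R
    P = orthoPoly (shift bs) (shift ls)
    P₂ = orthoPoly (shift (shift bs)) (shift (shift ls))

  cfTail-shift : ∀ m j bs ls → cfTail R bs ls m (suc j) ≡ cfTail R (shift bs) (shift ls) m j
  cfTail-shift zero j bs ls = ≡.refl
  cfTail-shift (suc m) j bs ls =
    ≡.cong (λ (N , D) → _⊖_ R (_⊛_ R (_⊖_ R (X R) (const R (bs (suc j)))) N) (_⊛_ R (const R (ls (suc (suc j)))) D) , N)
           (cfTail-shift m (suc j) bs ls)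

  cfTail-orthoPoly : ∀ m bs ls →
    (∀ n → proj₁ (cfTail R bs ls m 0) n ≈ orthoPoly bs ls (suc (suc m)) n) ×
    (∀ n → proj₂ (cfTail R bs ls m 0) n ≈ orthoPoly (shift bs) (shift ls) (suc m) n)
  cfTail-orthoPoly zero bs ls = linearFactor , λ _ → refl
    where
    linearFactor : ∀ n → X R n + - const R (bs 0) n ≈ orthoPoly bs ls 2 n
    linearFactor n = trans (constantTerm n) (sym (threeTerm-zero (bs 0) (ls 0) (const R 1#) n))
      where
      constantTerm : ∀ n → X R n + - const R (bs 0) n ≈ mulX (const R 1#) n + (- bs 0) * const R 1# n
      constantTerm zero = +-congˡ (sym (*-identityʳ _))
      constantTerm (suc zero) = +-congˡ (trans ε⁻¹≈ε (sym (zeroʳ _)))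
      constantTerm (suc (suc n)) = +-congˡ (trans ε⁻¹≈ε (sym (zeroʳ _)))
  cfTail-orthoPoly (suc m) bs ls = numerator , tailNumerator
    where
    tailNumerator : ∀ n → proj₁ (cfTail R bs ls m 1) n ≈ orthoPoly (shift bs) (shift ls) (suc (suc m)) n
    tailNumerator n = trans (reflexive (≡.cong (λ T → proj₁ T n) (cfTail-shift m 0 bs ls)))
                          (proj₁ (cfTail-orthoPoly m (shift bs) (shift ls)) n)
    tailDenominator : ∀ n → proj₂ (cfTail R bs ls m 1) n ≈ orthoPoly (shift (shift bs)) (shift (shift ls)) (suc m) n
    tailDenominator n = trans (reflexive (≡.cong (λ T → proj₂ T n) (cfTail-shift m 0 bs ls)))
                           (proj₂ (cfTail-orthoPoly m (shift bs) (shift ls)) n)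
    numerator : ∀ n → proj₁ (cfTail R bs ls (suc m) 0) n ≈ orthoPoly bs ls (suc (suc (suc m))) n
    numerator n = begin
      proj₁ (cfTail R bs ls (suc m) 0) n
        ≈⟨ ⊛-threeTerm (bs 0) (ls 1) (proj₁ (cfTail R bs ls m 1)) (proj₂ (cfTail R bs ls m 1)) n ⟩
      threeTerm (bs 0) (ls 1) (proj₁ (cfTail R bs ls m 1)) (proj₂ (cfTail R bs ls m 1)) n
        ≈⟨ threeTerm-cong (bs 0) (ls 1) tailNumerator tailDenominator n ⟩
      threeTerm (bs 0) (ls 1) (orthoPoly (shift bs) (shift ls) (suc (suc m)))
                              (orthoPoly (shift (shift bs)) (shift (shift ls)) (suc m)) n
        ≈⟨ orthoPoly-expandFirst (suc m) bs ls n ⟨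
      orthoPoly bs ls (suc (suc (suc m))) n ∎

  -- Linear recurrences on ℤ

  RecInt-combination : ∀ d cs g n (A : ℕ → Carrier) → RecInt R d cs g →
                       RecInt R d cs (λ z → sum0to R n (λ j → A j * g (z +ℤ + j)))
  RecInt-combination d cs g n A rec z = begin
    sum0to R n (λ j → A j * g (z +ℤ + j))
      ≈⟨ sum0to-cong n (λ j → *-congˡ (rec (z +ℤ + j))) ⟩
    sum0to R n (λ j → A j * sum1to R d (λ i → cs i * g ((z +ℤ + j) -ℤ + i)))
      ≈⟨ sum0to-cong n (λ j → *-distribˡ-sum1to d (A j) _) ⟩
    sum0to R n (λ j → sum1to R d (λ i → A j * (cs i * g ((z +ℤ + j) -ℤ + i))))
      ≈⟨ sum0to-sum1to-comm n d _ ⟩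
    sum1to R d (λ i → sum0to R n (λ j → A j * (cs i * g ((z +ℤ + j) -ℤ + i))))
      ≈⟨ sum1to-cong d (λ i → sum0to-cong n (λ j →
           trans (x∙yz≈y∙xz _ _ _) (*-congˡ (*-congˡ (reflexive (≡.cong g (+-sub-comm z (+ j) (+ i)))))))) ⟩
    sum1to R d (λ i → sum0to R n (λ j → cs i * (A j * g ((z -ℤ + i) +ℤ + j))))
      ≈⟨ sum1to-cong d (λ i → sym (*-distribˡ-sum0to n (cs i) _)) ⟩
    sum1to R d (λ i → cs i * sum0to R n (λ j → A j * g ((z -ℤ + i) +ℤ + j))) ∎

  invertible-cancel : ∀ {y c a} → y * c ≈ 1# → c * a ≈ 0# → a ≈ 0#
  invertible-cancel {y} {c} {a} yc≈1 ca≈0 = begin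
    a             ≈⟨ *-identityˡ a ⟨
    1# * a        ≈⟨ *-congʳ yc≈1 ⟨
    (y * c) * a   ≈⟨ *-assoc y c a ⟩
    y * (c * a)   ≈⟨ *-congˡ ca≈0 ⟩
    y * 0#        ≈⟨ zeroʳ y ⟩
    0#            ∎

  RecInt-vanishes : ∀ d cs y h → y * cs (suc d) ≈ 1# → RecInt R (suc d) cs h →
                    (∀ n → h (+ n) ≈ 0#) → ∀ z → h z ≈ 0#
  RecInt-vanishes d cs y h inv rec h⁺ (+ n) = h⁺ n
  RecInt-vanishes d cs y h inv rec h⁺ -[1+ m ] = vanishesFrom (suc m) 0
    where
    vanishesFrom : ∀ m t → h (+ t -ℤ + m) ≈ 0#
    vanishesFrom zero t = trans (reflexive (≡.cong h (ℤ.+-identityʳ (+ t)))) (h⁺ t)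
    vanishesFrom (suc m) (suc t) = trans (reflexive (≡.cong h (suc-sub-suc t m))) (vanishesFrom m t)
    vanishesFrom (suc m) zero = invertible-cancel inv lastTerm
      where
      earlierTerm : ∀ i → i ≤ d → cs i * h ((+ d -ℤ + m) -ℤ + i) ≈ 0#
      earlierTerm i i≤d = trans (*-congˡ (trans (reflexive (≡.cong h (sub-sub-≤ m i≤d))) (vanishesFrom m (d ∸ i)))) (zeroʳ _)
      lastTerm : cs (suc d) * h -[1+ m ] ≈ 0#
      lastTerm = begin
        cs (suc d) * h -[1+ m ]
          ≈⟨ +-identityˡ _ ⟨
        0# + cs (suc d) * h -[1+ m ]
          ≈⟨ +-cong (sum1to-zero-≤ d earlierTerm) (*-congˡ (reflexive (≡.cong h (sub-sub-suc d m)))) ⟨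
        sum1to R (suc d) (λ i → cs i * h ((+ d -ℤ + m) -ℤ + i))
          ≈⟨ rec (+ d -ℤ + m) ⟨
        h (+ d -ℤ + m)
          ≈⟨ vanishesFrom m d ⟩
        0# ∎

  -- Weighted Motzkin paths and the moment functional

  sumMap : ∀ {a} {A : Set a} → List A → (A → Carrier) → Carrier
  sumMap xs F = sumL R (map F xs)

  sumMap-cong : ∀ {a} {A : Set a} (xs : List A) {F G : A → Carrier} → (∀ p → F p ≈ G p) → sumMap xs F ≈ sumMap xs G
  sumMap-cong [] e = refl
  sumMap-cong (x ∷ xs) e = +-cong (e x) (sumMap-cong xs e)

  sumMap-zero : ∀ {a} {A : Set a} (xs : List A) {F : A → Carrier} → (∀ p → F p ≈ 0#) → sumMap xs F ≈ 0#
  sumMap-zero [] e = refl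
  sumMap-zero (x ∷ xs) e = trans (+-cong (e x) (sumMap-zero xs e)) (+-identityˡ 0#)

  sumMap-distrib-+ : ∀ {a} {A : Set a} (xs : List A) (F G : A → Carrier) →
                     sumMap xs (λ p → F p + G p) ≈ sumMap xs F + sumMap xs G
  sumMap-distrib-+ [] F G = sym (+-identityˡ 0#)
  sumMap-distrib-+ (x ∷ xs) F G = trans (+-congˡ (sumMap-distrib-+ xs F G)) (interchange _ _ _ _)

  *-distribˡ-sumMap : ∀ {a} {A : Set a} (xs : List A) x (F : A → Carrier) → x * sumMap xs F ≈ sumMap xs (λ p → x * F p)
  *-distribˡ-sumMap [] x F = zeroʳ x
  *-distribˡ-sumMap (y ∷ xs) x F = trans (distribˡ x _ _) (+-congˡ (*-distribˡ-sumMap xs x F))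

  sumMap-++ : ∀ {a} {A : Set a} (xs ys : List A) F → sumMap (xs ++ ys) F ≈ sumMap xs F + sumMap ys F
  sumMap-++ [] ys F = sym (+-identityˡ _)
  sumMap-++ (x ∷ xs) ys F = trans (+-congˡ (sumMap-++ xs ys F)) (sym (+-assoc _ _ _))

  sumMap-concatMap : ∀ {a} {A : Set a} (f : A → List A) xs F →
                     sumMap (concatMap f xs) F ≈ sumMap xs (λ p → sumMap (f p) F)
  sumMap-concatMap f [] F = refl
  sumMap-concatMap f (x ∷ xs) F = trans (sumMap-++ (f x) (concatMap f xs) F) (+-congˡ (sumMap-concatMap f xs F))

  sumMap-filterᵇ : ∀ {a} {A : Set a} (w : A → Carrier) (P : A → Bool) xs →
                   sumL R (map w (filterᵇ P xs)) ≈ sumMap xs (λ p → if P p then w p else 0#)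
  sumMap-filterᵇ w P [] = refl
  sumMap-filterᵇ w P (x ∷ xs) with P x
  ... | true = +-congˡ (sumMap-filterᵇ w P xs)
  ... | false = trans (sumMap-filterᵇ w P xs) (sym (+-identityˡ _))

  sumMap-if : ∀ {a} {A : Set a} (xs : List A) t (F : A → Carrier) →
              sumMap xs (λ p → if t then F p else 0#) ≈ (if t then sumMap xs F else 0#)
  sumMap-if xs true F = refl
  sumMap-if xs false F = sumMap-zero xs (λ _ → refl)

  +-cancel-scaled : ∀ u x y s t → ((u + (x * s + y * t)) + (- x) * s) + (- y) * t ≈ u
  +-cancel-scaled u x y s t = begin
    ((u + (x * s + y * t)) + (- x) * s) + (- y) * t
      ≈⟨ regroup u x y s t (- x) (- y) ⟩
    u + ((x * s + (- x) * s) + (y * t + (- y) * t))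
      ≈⟨ +-congˡ (+-cong (cancel x s) (cancel y t)) ⟩
    u + (0# + 0#)
      ≈⟨ trans (+-congˡ (+-identityʳ 0#)) (+-identityʳ u) ⟩
    u ∎
    where
    regroup : ∀ u x y s t x′ y′ → ((u + (x * s + y * t)) + x′ * s) + y′ * t ≈ u + ((x * s + x′ * s) + (y * t + y′ * t))
    regroup = solve 7 (λ u x y s t x′ y′ →
      ((u :+ (x :* s :+ y :* t)) :+ x′ :* s) :+ y′ :* t := u :+ ((x :* s :+ x′ :* s) :+ (y :* t :+ y′ :* t))) refl
    cancel : ∀ x s → x * s + (- x) * s ≈ 0#
    cancel x s = trans (sym (distribʳ s x (- x))) (trans (*-congʳ (-‿inverseʳ x)) (zeroˡ s))

  module Paths (k : ℕ) (b lam : ℕ → Carrier) where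

    pathSum : ℕ → ℕ → Carrier
    pathSum h n = sumL R (map (weight R b lam h) (filterᵇ (isMotzkin k h) (allSeqs n)))

    pathSum↓ : ℕ → ℕ → Carrier
    pathSum↓ zero n = 0#
    pathSum↓ (suc h) n = pathSum h n

    pathSum↑ : ℕ → ℕ → Carrier
    pathSum↑ h n = if h <ᵇ k then pathSum (suc h) n else 0#

    private
      admissible : ℕ → List Step → Carrier
      admissible h p = if isMotzkin k h p then weight R b lam h p else 0#

      pathSum-admissible : ∀ h n → pathSum h n ≈ sumMap (allSeqs n) (admissible h)
      pathSum-admissible h n = sumMap-filterᵇ (weight R b lam h) (isMotzkin k h) (allSeqs n)

      admissible-up : ∀ h p → admissible h (up ∷ p) ≡ (if h <ᵇ k then admissible (suc h) p else 0#)
      admissible-up zero p with 0 <ᵇ k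
      ... | true = ≡.refl
      ... | false = ≡.refl
      admissible-up (suc h) p with suc h <ᵇ k
      ... | true = ≡.refl
      ... | false = ≡.refl

      admissible-flat : ∀ h p → admissible h (flat ∷ p) ≈ b h * admissible h p
      admissible-flat zero p with isMotzkin k zero p
      ... | true = refl
      ... | false = sym (zeroʳ _)
      admissible-flat (suc h) p with isMotzkin k (suc h) p
      ... | true = refl
      ... | false = sym (zeroʳ _)

      admissible-down : ∀ h p → admissible (suc h) (down ∷ p) ≈ lam (suc h) * admissible h p
      admissible-down h p with isMotzkin k h p
      ... | true = refl
      ... | false = sym (zeroʳ _)

    pathSum-suc : ∀ h n → pathSum h (suc n) ≈ pathSum↑ h n + (b h * pathSum h n + lam h * pathSum↓ h n)
    pathSum-suc h n = begin
      pathSum h (suc n)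
        ≈⟨ pathSum-admissible h (suc n) ⟩
      sumMap (concatMap extend paths) (admissible h)
        ≈⟨ sumMap-concatMap extend paths (admissible h) ⟩
      sumMap paths (λ p → admissible h (up ∷ p) + (admissible h (flat ∷ p) + (admissible h (down ∷ p) + 0#)))
        ≈⟨ sumMap-cong paths (λ p → +-congˡ (+-congˡ (+-identityʳ _))) ⟩
      sumMap paths (λ p → admissible h (up ∷ p) + (admissible h (flat ∷ p) + admissible h (down ∷ p)))
        ≈⟨ trans (sumMap-distrib-+ paths _ _) (+-congˡ (sumMap-distrib-+ paths _ _)) ⟩
      sumMap paths (λ p → admissible h (up ∷ p)) +
        (sumMap paths (λ p → admissible h (flat ∷ p)) + sumMap paths (λ p → admissible h (down ∷ p)))
        ≈⟨ +-cong upSteps (+-cong flatSteps (downSteps h)) ⟩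
      pathSum↑ h n + (b h * pathSum h n + lam h * pathSum↓ h n) ∎
      where
      paths : List (List Step)
      paths = allSeqs n
      extend : List Step → List (List Step)
      extend p = (up ∷ p) ∷ (flat ∷ p) ∷ (down ∷ p) ∷ []
      upSteps : sumMap paths (λ p → admissible h (up ∷ p)) ≈ pathSum↑ h n
      upSteps = trans (sumMap-cong paths (λ p → reflexive (admissible-up h p)))
                      (trans (sumMap-if paths (h <ᵇ k) (admissible (suc h))) (if-pathSum (h <ᵇ k)))
        where
        if-pathSum : ∀ t → (if t then sumMap paths (admissible (suc h)) else 0#) ≈ (if t then pathSum (suc h) n else 0#)
        if-pathSum true = sym (pathSum-admissible (suc h) n)
        if-pathSum false = refl
      flatSteps : sumMap paths (λ p → admissible h (flat ∷ p)) ≈ b h * pathSum h n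
      flatSteps = trans (sumMap-cong paths (admissible-flat h))
                        (trans (sym (*-distribˡ-sumMap paths _ _)) (*-congˡ (sym (pathSum-admissible h n))))
      downSteps : ∀ h → sumMap paths (λ p → admissible h (down ∷ p)) ≈ lam h * pathSum↓ h n
      downSteps zero = trans (sumMap-zero paths (λ _ → refl)) (sym (zeroʳ _))
      downSteps (suc h) = trans (sumMap-cong paths (admissible-down h))
                        (trans (sym (*-distribˡ-sumMap paths _ _)) (*-congˡ (sym (pathSum-admissible h n))))

    private
      pathSum↑-< : ∀ {h} n → h < k → pathSum↑ h n ≈ pathSum (suc h) n
      pathSum↑-< {h} n h<k with h <ᵇ k | ℕ.<⇒<ᵇ h<k
      ... | true | _ = refl

      pathSum↑-top : ∀ n → pathSum↑ k n ≈ 0#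
      pathSum↑-top n with k <ᵇ k | ℕ.<ᵇ⇒< k k
      ... | true | k<k = ⊥-elim (ℕ.<-irrefl ≡.refl (k<k tt))
      ... | false | _ = refl

    P : ℕ → Series R
    P = orthoPoly b lam

    μ : ℕ → Carrier
    μ = pathSum 0

    -- ℒ r A = L(x^r A) for the moment functional L(x^n) = μ_n, and 𝒯 (suc s) A is the coefficient of x^s
    -- in the polynomial part of A(x) Σ_n μ_n x^{-n-1}; both only read A up to degree k + 1.
    ℒ : ℕ → Series R → Carrier
    ℒ r = pairing (suc k) id (λ j → μ (r +ℕ j))

    𝒯 : ℕ → Series R → Carrier
    𝒯 s = pairing (suc k) (s +ℕ_) μ

    ℒ-mulX : ∀ r A → A (suc k) ≈ 0# → ℒ r (mulX A) ≈ ℒ (suc r) A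
    ℒ-mulX r A A≈0 = begin
      ℒ r (mulX A)
        ≈⟨ sum0to-sucˡ k _ ⟩
      0# * μ (r +ℕ 0) + sum0to R k (λ j → A j * μ (r +ℕ suc j))
        ≈⟨ +-cong (zeroˡ _) (sum0to-cong k (λ j → *-congˡ (reflexive (≡.cong μ (ℕ.+-suc r j))))) ⟩
      0# + sum0to R k (λ j → A j * μ (suc r +ℕ j))
        ≈⟨ trans (+-identityˡ _) (sym (+-identityʳ _)) ⟩
      sum0to R k (λ j → A j * μ (suc r +ℕ j)) + 0#
        ≈⟨ +-congˡ (trans (*-congʳ A≈0) (zeroˡ _)) ⟨
      ℒ (suc r) A ∎

    ℒ-orthoPoly-step : ∀ h → h ≤ k → (∀ r → ℒ r (P (suc h)) ≈ pathSum h r) → (∀ r → ℒ r (P h) ≈ pathSum↓ h r) →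
                       ∀ r → ℒ r (P (suc (suc h))) ≈ pathSum↑ h r
    ℒ-orthoPoly-step h h≤k ℒP₁ ℒP₀ r = begin
      ℒ r (P (suc (suc h)))
        ≈⟨ pairing-threeTerm (suc k) id _ (b h) (lam h) (P (suc h)) (P h) ⟩
      (ℒ r (mulX (P (suc h))) + (- b h) * ℒ r (P (suc h))) + (- lam h) * ℒ r (P h)
        ≈⟨ +-cong (+-cong (trans (ℒ-mulX r (P (suc h)) (orthoPoly-degree b lam (suc h) (suc k) (s≤s h≤k))) (ℒP₁ (suc r)))
                          (*-congˡ (ℒP₁ r)))
                  (*-congˡ (ℒP₀ r)) ⟩
      (pathSum h (suc r) + (- b h) * pathSum h r) + (- lam h) * pathSum↓ h r
        ≈⟨ +-congʳ (+-congʳ (pathSum-suc h r)) ⟩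
      ((pathSum↑ h r + (b h * pathSum h r + lam h * pathSum↓ h r)) + (- b h) * pathSum h r) + (- lam h) * pathSum↓ h r
        ≈⟨ +-cancel-scaled _ _ _ _ _ ⟩
      pathSum↑ h r ∎

    ℒ-orthoPoly : ∀ m → m ≤ suc k → ∀ r → ℒ r (P m) ≈ pathSum↓ m r
    ℒ-orthoPoly zero _ r = pairing-zero (suc k) id _
    ℒ-orthoPoly (suc zero) _ r =
      trans (sum0to-head (suc k) _ (λ _ → zeroˡ _)) (trans (*-identityˡ _) (reflexive (≡.cong μ (ℕ.+-identityʳ r))))
    ℒ-orthoPoly (suc (suc h)) (s≤s h<k) r =
      trans (ℒ-orthoPoly-step h (ℕ.<⇒≤ h<k) (ℒ-orthoPoly (suc h) (ℕ.m≤n⇒m≤1+n h<k)) (ℒ-orthoPoly h (ℕ.m≤n⇒m≤1+n (ℕ.<⇒≤ h<k))) r)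
            (pathSum↑-< r h<k)

    ℒ-orthoPoly-top : ∀ r → ℒ r (P (suc (suc k))) ≈ 0#
    ℒ-orthoPoly-top r =
      trans (ℒ-orthoPoly-step k ℕ.≤-refl (ℒ-orthoPoly (suc k) ℕ.≤-refl) (ℒ-orthoPoly k (ℕ.n≤1+n k)) r) (pathSum↑-top r)

    Q : ℕ → Series R
    Q = orthoPoly (shift b) (shift lam)

    𝒯-orthoPoly : ∀ m → m ≤ suc k → ∀ s → 𝒯 (suc s) (P (suc m)) ≈ Q m s
    𝒯-orthoPoly zero _ s = pairing-zero (suc k) (suc s +ℕ_) μ
    𝒯-orthoPoly (suc zero) _ s = begin
      𝒯 (suc s) (P 2)
        ≈⟨ pairing-threeTerm (suc k) (suc s +ℕ_) μ (b 0) (lam 0) (P 1) (P 0) ⟩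
      (𝒯 s (P 1) + (- b 0) * 𝒯 (suc s) (P 1)) + (- lam 0) * 𝒯 (suc s) (P 0)
        ≈⟨ +-cong (+-congˡ (*-congˡ (𝒯-orthoPoly zero z≤n s))) (*-congˡ (pairing-zero (suc k) (suc s +ℕ_) μ)) ⟩
      (𝒯 s (P 1) + (- b 0) * 0#) + (- lam 0) * 0#
        ≈⟨ +-scaled-zeros _ _ _ ⟩
      𝒯 s (P 1)
        ≈⟨ leading s ⟩
      Q 1 s ∎
      where
      leading : ∀ s → 𝒯 s (P 1) ≈ Q 1 s
      leading zero = trans (ℒ-orthoPoly 1 (s≤s z≤n) 0) (+-identityʳ 1#)
      leading (suc s) = 𝒯-orthoPoly zero z≤n s
    𝒯-orthoPoly (suc (suc h)) h+2≤k+1 s = begin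
      𝒯 (suc s) (P (suc (suc (suc h))))
        ≈⟨ pairing-threeTerm (suc k) (suc s +ℕ_) μ (b (suc h)) (lam (suc h)) (P (suc (suc h))) (P (suc h)) ⟩
      (𝒯 s (P (suc (suc h))) + (- b (suc h)) * 𝒯 (suc s) (P (suc (suc h)))) + (- lam (suc h)) * 𝒯 (suc s) (P (suc h))
        ≈⟨ +-cong (+-cong (lowered s) (*-congˡ (𝒯-orthoPoly (suc h) h+1≤k+1 s))) (*-congˡ (𝒯-orthoPoly h h≤k+1 s)) ⟩
      Q (suc (suc h)) s ∎
      where
      h+1≤k+1 : suc h ≤ suc k
      h+1≤k+1 = ℕ.<⇒≤ h+2≤k+1
      h≤k+1 : h ≤ suc k
      h≤k+1 = ℕ.<⇒≤ h+1≤k+1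
      lowered : ∀ s → 𝒯 s (P (suc (suc h))) ≈ mulX (Q (suc h)) s
      lowered zero = ℒ-orthoPoly (suc (suc h)) h+2≤k+1 0
      lowered (suc s) = 𝒯-orthoPoly (suc h) h+1≤k+1 s

    P₊ : Series R
    P₊ = P (suc (suc k))

    module _ (g : ℤ → Carrier) where

      annihilated : ℤ → Carrier
      annihilated z = sum0to R (suc k) (λ j → P₊ j * g (z +ℤ + j))

      annihilated-ℕ : (∀ n → g (+ n) ≈ μ n) → ∀ n → annihilated (+ n) ≈ 0#
      annihilated-ℕ g≈μ n = trans (sum0to-cong (suc k) (λ j → *-congˡ (g≈μ (n +ℕ j)))) (ℒ-orthoPoly-top n)

      annihilated-negative : (∀ n → g (+ n) ≈ μ n) → ∀ m →
        annihilated -[1+ m ] ≈ sum0to R m (λ i → P₊ i * g -[1+ (m ∸ i) ]) + 𝒯 (suc m) P₊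
      annihilated-negative g≈μ m = begin
        sum0to R (suc k) f
          ≈⟨ sum0to-pad (suc k) (suc m) f (λ j k+1<j → trans (*-congʳ (orthoPoly-degree b lam _ j k+1<j)) (zeroˡ _)) ⟨
        sum0to R (suc k +ℕ suc m) f
          ≡⟨ ≡.cong (λ u → sum0to R u f) (ℕ.+-comm (suc k) (suc m)) ⟩
        sum0to R (suc (m +ℕ suc k)) f
          ≈⟨ sum0to-split m (suc k) f ⟩
        sum0to R m f + sum0to R (suc k) (λ i → f (suc (m +ℕ i)))
          ≈⟨ +-cong (sum0to-cong-≤ m (λ i i≤m → *-congˡ (reflexive (≡.cong g (-[1+]-+-≤ i≤m)))))
                    (sum0to-cong (suc k) (λ i → *-congˡ (trans (reflexive (≡.cong g (-[1+]-+-suc m i))) (g≈μ i)))) ⟩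
        sum0to R m (λ i → P₊ i * g -[1+ (m ∸ i) ]) + 𝒯 (suc m) P₊ ∎
        where
        f : ℕ → Carrier
        f j = P₊ j * g (-[1+ m ] +ℤ + j)

      cfDen-⊛-negSeries : (∀ n → g (+ n) ≈ μ n) → (∀ m → annihilated -[1+ m ] ≈ 0#) →
                          ∀ n → _⊛_ R (cfDen R k b lam) (negSeries R g) n ≈ cfNum R k b lam n
      cfDen-⊛-negSeries g≈μ vanishes zero = trans (zeroʳ _) (sym (trans (*-congˡ (zeroˡ _)) (zeroʳ _)))
      cfDen-⊛-negSeries g≈μ vanishes (suc m) = begin
        sum0to R m (λ i → N i * G (suc m ∸ i)) + N (suc m) * G (m ∸ m)
          ≈⟨ +-cong (sum0to-cong-≤ m (λ i i≤m → *-cong (N≈P₊ i) (reflexive (≡.cong G (ℕ.+-∸-assoc 1 i≤m)))))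
                    (trans (*-congˡ (reflexive (≡.cong G (ℕ.n∸n≡0 m)))) (zeroʳ _)) ⟩
        sum0to R m (λ i → P₊ i * g -[1+ (m ∸ i) ]) + 0#
          ≈⟨ +-identityʳ _ ⟩
        sum0to R m (λ i → P₊ i * g -[1+ (m ∸ i) ])
          ≈⟨ inverseˡ-unique _ _ (trans (sym (annihilated-negative g≈μ m)) (vanishes m)) ⟩
        - 𝒯 (suc m) P₊
          ≈⟨ -‿cong (𝒯-orthoPoly (suc k) ℕ.≤-refl m) ⟩
        - Q (suc k) m
          ≈⟨ -1*x≈-x _ ⟨
        - 1# * Q (suc k) m
          ≈⟨ *-congˡ (trans (X-⊛ D (suc m)) (D≈Q m)) ⟨
        - 1# * _⊛_ R (X R) D (suc m)
          ≈⟨ const-⊛ (- 1#) (_⊛_ R (X R) D) (suc m) ⟨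
        cfNum R k b lam (suc m) ∎
        where
        N D G : Series R
        N = proj₁ (cfTail R b lam k 0)
        D = proj₂ (cfTail R b lam k 0)
        G = negSeries R g
        N≈P₊ : ∀ n → N n ≈ P₊ n
        N≈P₊ = proj₁ (cfTail-orthoPoly k b lam)
        D≈Q : ∀ n → D n ≈ Q (suc k) n
        D≈Q = proj₂ (cfTail-orthoPoly k b lam)

proposition2p7 : {c ℓ : Level} (R : CommutativeRing c ℓ) → IsField R →
    let open CommutativeRing R in
    (k : ℕ) (b lam : ℕ → Carrier) →
    (d : ℕ) (cs : ℕ → Carrier) → 1 ≤ d → ¬ (cs d ≈ 0#) →
    RecNat R d cs (mu R k b lam) →
    (g : ℤ → Carrier) → (∀ (n : ℕ) → g (+ n) ≈ mu R k b lam n) →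
    RecInt R d cs g →
    ∀ (n : ℕ) → _⊛_ R (cfDen R k b lam) (negSeries R g) n ≈ cfNum R k b lam n
proposition2p7 R isField k b lam (suc d) cs (s≤s z≤n) cs≉0 _ g g≈μ rec =
  -- The ignored recurrence on ℕ follows from the one on ℤ; only the latter is used.
  cfDen-⊛-negSeries g g≈μ (λ m → RecInt-vanishes R d cs y (annihilated g) y*cs≈1
                                   (RecInt-combination R (suc d) cs g (suc k) P₊ rec) (annihilated-ℕ g g≈μ) -[1+ m ])
  where
  open CommutativeRing R using (Carrier; _*_; _≈_; 1#; trans; *-comm)
  open Paths R k b lam
  y : Carrier
  y = proj₁ (IsField.inverse isField (cs (suc d)) cs≉0)
  y*cs≈1 : y * cs (suc d) ≈ 1#
  y*cs≈1 = trans (*-comm y _) (proj₂ (IsField.inverse isField (cs (suc d)) cs≉0))
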